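{- Let $(V,E)$ be a connected interval graph and $v,u\in V$ with $\neg\,v\,E\,u$. Define $B_0(v,u)=\{v,u\}$, $B_{n+1}(v,u)=\{w\in V\mid\exists z,z'\in B_n(v,u)\,(z\,E\,w\wedge\neg\,z'\,E\,w)\}$ and $B(v,u)=\bigcup_n B_n(v,u)$. Then $B(v,u)$ is a buried subgraph of $(V,E)$ if and only if $R(B(v,u))\neq\emptyset$.
   Context: A graph $(V,E)$ has $E$ symmetric; connected means any two vertices are joined by a path. An interval graph is a reflexive graph for which there exist a linear order $L$ and an assignment of a nonempty interval $F(v)\subseteq L$ to each vertex with $v\,E\,u\iff F(v)\cap F(u)\ne\emptyset$. For $B\subseteq V$, $K(B)=\{x\in V\mid\forall b\in B\,(x\,E\,b)\}$, $R(B)=V\setminus(B\cup K(B))$; $B$ is a buried subgraph if (i) some $a,b\in B$ satisfy $\neg\,a\,E\,b$; (ii) $K(B)\cap B=\emptyset$ and $R(B)\ne\emptyset$; (iii) $\neg\,b\,E\,r$ for all $b\in B$, $r\in R(B)$. -}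

module Defs where

open import Level using (0ℓ)
open import Data.Nat using (ℕ; zero; suc)
open import Data.Product using (Σ; ∃; ∃-syntax; _×_; _,_)
open import Data.Empty using (⊥)
open import Data.Sum using (_⊎_)
open import Relation.Nullary using (¬_)
open import Relation.Binary.PropositionalEquality using (_≡_)
open import Relation.Binary.Structures using (IsTotalOrder)

Subset : Set → Set₁
Subset V = V → Set

Rel : Set → Set₁
Rel V = V → V → Set

Symmetric : {V : Set} → Rel V → Set
Symmetric {V} E = ∀ (x y : V) → E x y → E y x

Reflexive : {V : Set} → Rel V → Set
Reflexive {V} E = ∀ (x : V) → E x x

data Path {V : Set} (E : Rel V) : V → V → Set where
  here : ∀ {x} → Path E x x
  step : ∀ {x y z} → E x y → Path E y z → Path E x z

Connected : {V : Set} → Rel V → Set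
Connected {V} E = ∀ (x y : V) → Path E x y

IsInterval : {L : Set} → (L → L → Set) → Subset L → Set
IsInterval {L} _≤_ I =
  (∃[ x ] I x) ×
  (∀ (a b c : L) → I a → I c → a ≤ b → b ≤ c → I b)

IsIntervalGraph : {V : Set} → Rel V → Set₁
IsIntervalGraph {V} E =
  Reflexive E ×
  Σ Set λ L → Σ (L → L → Set) λ _≤_ → IsTotalOrder _≡_ _≤_ ×
  Σ (V → Subset L) λ F →
    (∀ v → IsInterval _≤_ (F v)) ×
    (∀ v u → (E v u → ∃[ x ] (F v x × F u x)) × (∃[ x ] (F v x × F u x) → E v u))

module _ {V : Set} (E : Rel V) where

  K : Subset V → Subset V
  K B x = ∀ b → B b → E x b

  R : Subset V → Subset V
  R B x = ¬ B x × ¬ K B x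

  NonEmpty : Subset V → Set
  NonEmpty S = ∃[ x ] S x

  IsBuried : Subset V → Set
  IsBuried B =
    (∃[ a ] ∃[ b ] (B a × B b × ¬ E a b)) ×
    ((∀ x → K B x → B x → ⊥) × NonEmpty (R B)) ×
    (∀ b r → B b → R B r → ¬ E b r)

  Bn : V → V → ℕ → Subset V
  Bn v u zero w = (w ≡ v) ⊎ (w ≡ u)
  Bn v u (suc n) w = ∃[ z ] ∃[ z' ] (Bn v u n z × Bn v u n z' × E z w × ¬ E z' w)

  Bvu : V → V → Subset V
  Bvu v u w = ∃[ n ] Bn v u n w

-- Every member of B(v,u) has a non-neighbour in B(v,u) (v and u are each other's; a
-- member of B_{n+1} has one in B_n), so B(v,u) misses K(B(v,u)). By reflexivity B_0 ⊆ B_1,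
-- hence the B_n increase and B(v,u) is closed under the generating rule. So a vertex outside
-- B(v,u) with a neighbour in B(v,u) is adjacent to all of B(v,u): it lies in K(B(v,u)),
-- not in R(B(v,u)).
module Submission where

open import Defs
open import Level using (0ℓ)
open import Axiom.ExcludedMiddle using (ExcludedMiddle)
open import Axiom.DoubleNegationElimination using (DoubleNegationElimination; em⇒dne)
open import Data.Product using (_×_; _,_; proj₁; proj₂; ∃-syntax)
open import Data.Sum using (inj₁; inj₂)
open import Data.Nat using (zero; suc; _+_)
open import Data.Nat.Properties using (+-comm)
open import Function using (_∘_)
open import Relation.Nullary using (¬_)
open import Relation.Binary.PropositionalEquality using (refl; subst)

module _ {V : Set} {E : Rel V} (sym : Symmetric E) {v u : V} (v≁u : ¬ E v u) where

  Bvu-hasNonNeighbour : ∀ {w} → Bvu E v u w → ∃[ z ] (Bvu E v u z × ¬ E z w)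
  Bvu-hasNonNeighbour (zero , inj₁ refl) = u , (0 , inj₂ refl) , v≁u ∘ sym u v
  Bvu-hasNonNeighbour (zero , inj₂ refl) = v , (0 , inj₁ refl) , v≁u
  Bvu-hasNonNeighbour (suc n , _ , z , _ , Bz , _ , z≁w) = z , (n , Bz) , z≁w

  Bvu-disjoint-K : ∀ x → K E (Bvu E v u) x → ¬ Bvu E v u x
  Bvu-disjoint-K x Kx Bx with Bvu-hasNonNeighbour Bx
  ... | z , Bz , z≁x = z≁x (sym x z (Kx z Bz))

  module _ (rfl : Reflexive E) where

    Bn-suc : ∀ n {w} → Bn E v u n w → Bn E v u (suc n) w
    Bn-suc zero (inj₁ refl) = v , u , inj₁ refl , inj₂ refl , rfl v , v≁u ∘ sym u v
    Bn-suc zero (inj₂ refl) = u , v , inj₂ refl , inj₁ refl , rfl u , v≁u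
    Bn-suc (suc n) (z , z' , Bz , Bz' , z∼w , z'≁w) =
      z , z' , Bn-suc n Bz , Bn-suc n Bz' , z∼w , z'≁w

    Bn-raise : ∀ k {n w} → Bn E v u n w → Bn E v u (k + n) w
    Bn-raise zero    Bw = Bw
    Bn-raise (suc k) Bw = Bn-suc _ (Bn-raise k Bw)

    Bvu-closed : ∀ {z z' w} → Bvu E v u z → Bvu E v u z' → E z w → ¬ E z' w →
                 Bvu E v u w
    Bvu-closed {z' = z'} (n , Bz) (m , Bz') z∼w z'≁w =
      suc (m + n) , _ , _ , Bn-raise m Bz ,
      subst (λ k → Bn E v u k z') (+-comm n m) (Bn-raise n Bz') , z∼w , z'≁w

    Bvu-neighbour⇒K : DoubleNegationElimination 0ℓ → ∀ {b r} →
                      Bvu E v u b → ¬ Bvu E v u r → E b r → K E (Bvu E v u) r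
    Bvu-neighbour⇒K dne Bb ¬Br b∼r c Bc =
      dne λ r≁c → ¬Br (Bvu-closed Bb Bc b∼r (r≁c ∘ sym c _))

mainTheorem8 : ExcludedMiddle 0ℓ →
    (V : Set) (E : Rel V) → Symmetric E → Connected E → IsIntervalGraph E →
    (v u : V) → ¬ E v u →
    (IsBuried E (Bvu E v u) → NonEmpty E (R E (Bvu E v u))) ×
    (NonEmpty E (R E (Bvu E v u)) → IsBuried E (Bvu E v u))
mainTheorem8 em V E sym _ (rfl , _) v u v≁u =
  proj₂ ∘ proj₁ ∘ proj₂ ,
  λ R≠∅ → (v , u , (0 , inj₁ refl) , (0 , inj₂ refl) , v≁u) ,
          (Bvu-disjoint-K sym v≁u , R≠∅) ,
          λ b r Bb (¬Br , ¬Kr) b∼r →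
            ¬Kr (Bvu-neighbour⇒K sym v≁u rfl (em⇒dne em) Bb ¬Br b∼r)
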